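{- Let $r,s,n\in\mathbb N=\{1,2,3,\dots\}$ and let $\ell$ be an integer with $0\le \ell\le n$. Then $$ \binom{\ell+r-1}{r-1}\binom{n-\ell+s-1}{s-1}\sum_{j=1}^{r-1}\frac{1}{\ell+j}=\sum_{t=0}^{r+s-3}a_{2}(r,s,n,t)\,\ell^t, $$ where $$ a_{2}(r,s,n,t)=\frac{1}{(r-1)!\,(s-1)!}\sum_{\substack{t_{1}+t_{2}=t\\ 0 \le t_{1} \le r-2\\ 0 \le t_{2} \le s-1 }} s_{u}(r,t_{1}+2)\,(t_{1}+1) \sum_{k_{2}=t_{2}}^{s-1} s_{u}(s,k_{2}+1) \binom{k_{2}}{t_{2}} (-1)^{t_{2}} n^{k_{2}-t_{2}}. $$
   Context: $s_u(n,k)$ denotes the unsigned Stirling numbers of the first kind, defined by $x(x+1)\cdots(x+n-1)=\sum_{k=0}^n s_u(n,k)x^k$ (with the empty product equal to $1$). An empty sum equals $0$ (so the sum $\sum_{j=1}^{r-1}$ is $0$ when $r=1$). The convention $0^0=1$ is used. -}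

module Defs where

open import Data.Nat as ℕ using (ℕ; zero; suc; _∸_; _≡ᵇ_; _!)
import Data.Nat.Properties as ℕP
open import Data.Nat.Combinatorics using (_C_)
open import Data.List using (List; []; _∷_)
open import Data.Bool using (if_then_else_)
open import Data.Integer as ℤ using (ℤ; +_)
open import Data.Rational as ℚ using (ℚ; 0ℚ; 1ℚ; _/_)

sumℚ : ℕ → (ℕ → ℚ) → ℚ
sumℚ zero    f = 0ℚ
sumℚ (suc m) f = sumℚ m f ℚ.+ f m

sumℤ : ℕ → (ℕ → ℤ) → ℤ
sumℤ zero    f = + 0
sumℤ (suc m) f = sumℤ m f ℤ.+ f m

powℚ : ℚ → ℕ → ℚ
powℚ q zero    = 1ℚ
powℚ q (suc k) = powℚ q k ℚ.* q

-- Polynomials with ℕ coefficients as coefficient lists (constant term first)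
addP : List ℕ → List ℕ → List ℕ
addP []       q        = q
addP (a ∷ p)  []       = a ∷ p
addP (a ∷ p)  (b ∷ q)  = (a ℕ.+ b) ∷ addP p q

scaleP : ℕ → List ℕ → List ℕ
scaleP c []      = []
scaleP c (a ∷ p) = (c ℕ.* a) ∷ scaleP c p

mulXplus : ℕ → List ℕ → List ℕ
mulXplus c p = addP (0 ∷ p) (scaleP c p)

rising : ℕ → List ℕ
rising zero    = 1 ∷ []
rising (suc n) = mulXplus n (rising n)

coeff : List ℕ → ℕ → ℕ
coeff []      k       = 0
coeff (a ∷ p) zero    = a
coeff (a ∷ p) (suc k) = coeff p k

-- unsigned Stirling numbers of the first kind:
-- x(x+1)...(x+n-1) = Σ_k s_u(n,k) x^k
su : ℕ → ℕ → ℕ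
su n k = coeff (rising n) k

-- inner sum  Σ_{k2=t2}^{s-1} s_u(s,k2+1) C(k2,t2) (-1)^t2 n^(k2-t2)   (k2 = t2 + i)
innerSum : ℕ → ℕ → ℕ → ℤ
innerSum s n t2 =
  sumℤ (s ∸ t2) (λ i →
    ℤ.+ (su s (t2 ℕ.+ i ℕ.+ 1) ℕ.* ((t2 ℕ.+ i) C t2) ℕ.* (n ℕ.^ i))
      ℤ.* (ℤ.-1ℤ ℤ.^ t2))

a2 : ℕ → ℕ → ℕ → ℕ → ℚ
a2 r s n t =
  (+ 1 / (((r ∸ 1) !) ℕ.* ((s ∸ 1) !))) {{ℕP._!*_!≢0 (r ∸ 1) (s ∸ 1)}} ℚ.*
  (sumℤ (r ∸ 1) (λ t1 → sumℤ s (λ t2 →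
     if (t1 ℕ.+ t2) ≡ᵇ t
       then ℤ.+ (su r (t1 ℕ.+ 2) ℕ.* (t1 ℕ.+ 1)) ℤ.* innerSum s n t2
       else + 0)) / 1)

-- Write r = m + 1, s = k + 1 and V_m(x) = (x + 1)(x + 2) ⋯ (x + m) = Σ_t s_u(m + 1, t + 1) xᵗ.
-- Then V_m(ℓ) = C(ℓ + m, m) · m!, and logarithmic differentiation gives
-- V_m′(ℓ) = V_m(ℓ) · Σ_{i<m} 1/(ℓ + 1 + i).  The factors s_u(r, t₁ + 2)(t₁ + 1) in a₂ are the
-- coefficients of V_m′, and by the binomial theorem the inner sum over k₂ is the coefficient of
-- x^{t₂} in V_k(n − x); so the sum over t₁ + t₂ = t is the t-th coefficient of V_m′(x) V_k(n − x).
-- Evaluating at x = ℓ and dividing by m! k! gives the left-hand side.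

module Submission where

open import Defs
open import Data.Bool using (true; false; if_then_else_)
open import Data.List using ([]; _∷_)
open import Data.Nat as ℕ using (ℕ; zero; suc; _∸_; _≤_; _<_; s≤s; _≡ᵇ_; _!)
import Data.Nat.Properties as ℕP
open import Data.Nat.Combinatorics using (_C_; nCk≡n!/k![n-k]!; k![n∸k]!∣n!)
open import Data.Nat.Coprimality using (1-coprimeTo) renaming (sym to coprime-sym)
open import Data.Nat.DivMod using (m/n*n≡m)
open import Data.Integer as ℤ using (ℤ; +_; -_; _+_; _*_; _^_)
import Data.Integer.Properties as ℤP
open import Data.Integer.Solver using (module +-*-Solver)
open import Data.Rational as ℚ using (ℚ; _/_; 1ℚ)
import Data.Rational.Properties as ℚP
open import Data.Rational.Literals using (fromℤ)
import Data.Rational.Solver as ℚSolver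
open import Data.Fin using (toℕ; fromℕ; inject₁)
import Data.Fin.Properties as FinP
open import Relation.Binary.PropositionalEquality
open ≡-Reasoning

import Algebra.Properties.CommutativeSemiring.Binomial ℤP.+-*-commutativeSemiring as Binomial
import Algebra.Properties.CommutativeSemiring.Exp ℤP.+-*-commutativeSemiring as Exp
import Algebra.Properties.Semiring.Mult ℤP.+-*-semiring as Mult
open import Algebra.Properties.Semiring.Sum ℤP.+-*-semiring using (sum; sum-init-last; sum-cong-≗)

open +-*-Solver using (solve; _:+_; _:*_; _:=_; con)
module QS = ℚSolver.+-*-Solver

sumℤ-cong : ∀ m {f g : ℕ → ℤ} → (∀ i → i < m → f i ≡ g i) → sumℤ m f ≡ sumℤ m g
sumℤ-cong zero    f≡g = refl
sumℤ-cong (suc m) f≡g =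
  cong₂ _+_ (sumℤ-cong m (λ i i<m → f≡g i (ℕP.m<n⇒m<1+n i<m))) (f≡g m (ℕP.n<1+n m))

sumℤ-0 : ∀ m → sumℤ m (λ _ → + 0) ≡ + 0
sumℤ-0 zero    = refl
sumℤ-0 (suc m) = cong (_+ + 0) (sumℤ-0 m)

sumℤ-+ : ∀ m (f g : ℕ → ℤ) → sumℤ m (λ i → f i + g i) ≡ sumℤ m f + sumℤ m g
sumℤ-+ zero    f g = refl
sumℤ-+ (suc m) f g = begin
  sumℤ m (λ i → f i + g i) + (f m + g m) ≡⟨ cong (_+ (f m + g m)) (sumℤ-+ m f g) ⟩
  (sumℤ m f + sumℤ m g) + (f m + g m)   ≡⟨ solve 4 (λ F G a b → (F :+ G) :+ (a :+ b) := (F :+ a) :+ (G :+ b))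
                                             refl (sumℤ m f) (sumℤ m g) (f m) (g m) ⟩
  (sumℤ m f + f m) + (sumℤ m g + g m)   ∎

sumℤ-*ˡ : ∀ m c (f : ℕ → ℤ) → c * sumℤ m f ≡ sumℤ m (λ i → c * f i)
sumℤ-*ˡ zero    c f = ℤP.*-zeroʳ c
sumℤ-*ˡ (suc m) c f =
  trans (ℤP.*-distribˡ-+ c (sumℤ m f) (f m)) (cong (_+ c * f m) (sumℤ-*ˡ m c f))

sumℤ-*ʳ : ∀ m c (f : ℕ → ℤ) → sumℤ m f * c ≡ sumℤ m (λ i → f i * c)
sumℤ-*ʳ m c f = begin
  sumℤ m f * c              ≡⟨ ℤP.*-comm (sumℤ m f) c ⟩
  c * sumℤ m f              ≡⟨ sumℤ-*ˡ m c f ⟩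
  sumℤ m (λ i → c * f i)    ≡⟨ sumℤ-cong m (λ i _ → ℤP.*-comm c (f i)) ⟩
  sumℤ m (λ i → f i * c)    ∎

sumℤ-swap : ∀ m n (f : ℕ → ℕ → ℤ) →
  sumℤ m (λ i → sumℤ n (f i)) ≡ sumℤ n (λ j → sumℤ m (λ i → f i j))
sumℤ-swap zero    n f = sym (sumℤ-0 n)
sumℤ-swap (suc m) n f = begin
  sumℤ m (λ i → sumℤ n (f i)) + sumℤ n (f m)          ≡⟨ cong (_+ sumℤ n (f m)) (sumℤ-swap m n f) ⟩
  sumℤ n (λ j → sumℤ m (λ i → f i j)) + sumℤ n (f m)  ≡⟨ sumℤ-+ n _ (f m) ⟨
  sumℤ n (λ j → sumℤ m (λ i → f i j) + f m j)         ∎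

sumℤ-suc : ∀ m (f : ℕ → ℤ) → sumℤ (suc m) f ≡ f 0 + sumℤ m (λ i → f (suc i))
sumℤ-suc zero    f = trans (ℤP.+-identityˡ (f 0)) (sym (ℤP.+-identityʳ (f 0)))
sumℤ-suc (suc m) f = trans (cong (_+ f (suc m)) (sumℤ-suc m f)) (ℤP.+-assoc (f 0) _ _)

sumℤ-select : ∀ m k (f : ℕ → ℤ) → k < m → sumℤ m (λ i → if k ≡ᵇ i then f i else + 0) ≡ f k
sumℤ-select (suc m) zero    f _ = begin
  sumℤ (suc m) (λ i → if 0 ≡ᵇ i then f i else + 0) ≡⟨ sumℤ-suc m _ ⟩
  f 0 + sumℤ m (λ _ → + 0)                          ≡⟨ cong (_+_ (f 0)) (sumℤ-0 m) ⟩
  f 0 + + 0                                         ≡⟨ ℤP.+-identityʳ (f 0) ⟩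
  f 0                                               ∎
sumℤ-select (suc m) (suc k) f (s≤s k<m) = begin
  sumℤ (suc m) (λ i → if suc k ≡ᵇ i then f i else + 0)     ≡⟨ sumℤ-suc m _ ⟩
  + 0 + sumℤ m (λ i → if k ≡ᵇ i then f (suc i) else + 0)  ≡⟨ ℤP.+-identityˡ _ ⟩
  sumℤ m (λ i → if k ≡ᵇ i then f (suc i) else + 0)        ≡⟨ sumℤ-select m k (λ i → f (suc i)) k<m ⟩
  f (suc k)                                               ∎

-- The binomial theorem, transported from the library's semiring version

sumℤ≡sum : ∀ m (f : ℕ → ℤ) → sumℤ m f ≡ sum {m} (λ i → f (toℕ i))
sumℤ≡sum zero    f = refl
sumℤ≡sum (suc m) f = begin
  sumℤ m f + f m
    ≡⟨ cong₂ _+_ (trans (sumℤ≡sum m f) (sum-cong-≗ {m} (λ i → cong f (sym (FinP.toℕ-inject₁ i)))))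
                 (cong f (sym (FinP.toℕ-fromℕ m))) ⟩
  sum {m} (λ i → f (toℕ (inject₁ i))) + f (toℕ (fromℕ m))
    ≡⟨ sum-init-last {m} (λ i → f (toℕ i)) ⟨
  sum {suc m} (λ i → f (toℕ i)) ∎

^≡Exp^ : ∀ x n → x ^ n ≡ x Exp.^ n
^≡Exp^ x zero    = refl
^≡Exp^ x (suc n) = cong (x *_) (^≡Exp^ x n)

×≡pos* : ∀ n x → n Mult.× x ≡ + n * x
×≡pos* zero    x = refl
×≡pos* (suc n) x = begin
  x + n Mult.× x    ≡⟨ cong (_+_ x) (×≡pos* n x) ⟩
  x + + n * x       ≡⟨ cong (_+ + n * x) (ℤP.*-identityˡ x) ⟨
  + 1 * x + + n * x ≡⟨ ℤP.*-distribʳ-+ x (+ 1) (+ n) ⟨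
  + suc n * x       ∎

binomial : ∀ d (x y : ℤ) → (x + y) ^ d ≡ sumℤ (suc d) (λ t → + (d C t) * (x ^ t * y ^ (d ∸ t)))
binomial d x y = begin
  (x + y) ^ d                      ≡⟨ ^≡Exp^ (x + y) d ⟩
  (x + y) Exp.^ d                  ≡⟨ Binomial.theorem d x y ⟩
  Binomial.binomialExpansion x y d ≡⟨ sum-cong-≗ {suc d} term ⟩
  sum {suc d} (λ i → + (d C toℕ i) * (x ^ toℕ i * y ^ (d ∸ toℕ i))) ≡⟨ sumℤ≡sum (suc d) _ ⟨
  sumℤ (suc d) (λ t → + (d C t) * (x ^ t * y ^ (d ∸ t))) ∎
  where
  term : ∀ i → Binomial.binomialTerm x y d i ≡ + (d C toℕ i) * (x ^ toℕ i * y ^ (d ∸ toℕ i))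
  term i = trans (×≡pos* (d C toℕ i) _)
    (cong₂ (λ a b → + (d C toℕ i) * (a * b)) (sym (^≡Exp^ x (toℕ i))) (sym (^≡Exp^ y (d ∸ toℕ i))))

^-distribʳ-* : ∀ x y n → (x * y) ^ n ≡ x ^ n * y ^ n
^-distribʳ-* x y n = begin
  (x * y) ^ n             ≡⟨ ^≡Exp^ (x * y) n ⟩
  (x * y) Exp.^ n         ≡⟨ Exp.^-distrib-* x y n ⟩
  x Exp.^ n * y Exp.^ n   ≡⟨ cong₂ _*_ (^≡Exp^ x n) (^≡Exp^ y n) ⟨
  x ^ n * y ^ n           ∎

pos-^ : ∀ n i → + (n ℕ.^ i) ≡ (+ n) ^ i
pos-^ n zero    = refl
pos-^ n (suc i) = trans (ℤP.pos-* n (n ℕ.^ i)) (cong (+ n *_) (pos-^ n i))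

-- Polynomials as coefficient sequences

poly : ℕ → (ℕ → ℤ) → ℤ → ℤ
poly n c x = sumℤ n (λ t → c t * x ^ t)

poly-cong : ∀ n {c d : ℕ → ℤ} x → (∀ t → c t ≡ d t) → poly n c x ≡ poly n d x
poly-cong n x c≡d = sumℤ-cong n (λ t _ → cong (_* x ^ t) (c≡d t))

poly-+ : ∀ n (c d : ℕ → ℤ) x → poly n (λ t → c t + d t) x ≡ poly n c x + poly n d x
poly-+ n c d x = trans (sumℤ-cong n (λ t _ → ℤP.*-distribʳ-+ (x ^ t) (c t) (d t))) (sumℤ-+ n _ _)

poly-*ˡ : ∀ n a (c : ℕ → ℤ) x → poly n (λ t → a * c t) x ≡ a * poly n c x
poly-*ˡ n a c x = trans (sumℤ-cong n (λ t _ → ℤP.*-assoc a (c t) (x ^ t))) (sym (sumℤ-*ˡ n a _))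

poly-suc-vanishing : ∀ n (c : ℕ → ℤ) x → c n ≡ + 0 → poly (suc n) c x ≡ poly n c x
poly-suc-vanishing n c x cₙ≡0 = begin
  poly n c x + c n * x ^ n ≡⟨ cong (λ a → poly n c x + a * x ^ n) cₙ≡0 ⟩
  poly n c x + + 0         ≡⟨ ℤP.+-identityʳ (poly n c x) ⟩
  poly n c x               ∎

shift : (ℕ → ℤ) → ℕ → ℤ
shift c zero    = + 0
shift c (suc t) = c t

poly-shift : ∀ n (c : ℕ → ℤ) x → poly (suc n) (shift c) x ≡ x * poly n c x
poly-shift n c x = begin
  poly (suc n) (shift c) x
    ≡⟨ sumℤ-suc n _ ⟩
  + 0 * + 1 + sumℤ n (λ t → c t * (x * x ^ t))
    ≡⟨ ℤP.+-identityˡ _ ⟩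
  sumℤ n (λ t → c t * (x * x ^ t))
    ≡⟨ sumℤ-cong n (λ t _ → solve 3 (λ C X P → C :* (X :* P) := X :* (C :* P)) refl (c t) x (x ^ t)) ⟩
  sumℤ n (λ t → x * (c t * x ^ t))
    ≡⟨ sumℤ-*ˡ n x _ ⟨
  x * poly n c x
    ∎

linearMul : ℤ → (ℕ → ℤ) → ℕ → ℤ
linearMul a c t = shift c t + a * c t

poly-linearMul : ∀ n a (c : ℕ → ℤ) x → c n ≡ + 0 → poly (suc n) (linearMul a c) x ≡ poly n c x * (x + a)
poly-linearMul n a c x cₙ≡0 = begin
  poly (suc n) (linearMul a c) x
    ≡⟨ poly-+ (suc n) (shift c) _ x ⟩
  poly (suc n) (shift c) x + poly (suc n) (λ t → a * c t) x
    ≡⟨ cong₂ _+_ (poly-shift n c x) (poly-*ˡ (suc n) a c x) ⟩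
  x * poly n c x + a * poly (suc n) c x
    ≡⟨ cong (λ p → x * poly n c x + a * p) (poly-suc-vanishing n c x cₙ≡0) ⟩
  x * poly n c x + a * poly n c x
    ≡⟨ solve 3 (λ X A P → X :* P :+ A :* P := P :* (X :+ A)) refl x a (poly n c x) ⟩
  poly n c x * (x + a)
    ∎

deriv : (ℕ → ℤ) → ℕ → ℤ
deriv c t = + suc t * c (suc t)

deriv-linearMul : ∀ a (c : ℕ → ℤ) t → deriv (linearMul a c) t ≡ (shift (deriv c) t + c t) + a * deriv c t
deriv-linearMul a c zero    =
  solve 3 (λ A C₀ C₁ → con (+ 1) :* (C₀ :+ A :* C₁) := (con (+ 0) :+ C₀) :+ A :* (con (+ 1) :* C₁))
    refl a (c 0) (c 1)
deriv-linearMul a c (suc t) =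
  solve 4 (λ T A C₁ C₂ → (con (+ 1) :+ T) :* (C₁ :+ A :* C₂) := (T :* C₁ :+ C₁) :+ A :* ((con (+ 1) :+ T) :* C₂))
    refl (+ suc t) a (c (suc t)) (c (suc (suc t)))

poly-deriv-linearMul : ∀ n a (c : ℕ → ℤ) x → c (suc n) ≡ + 0 →
  poly (suc n) (deriv (linearMul a c)) x ≡ poly n (deriv c) x * (x + a) + poly (suc n) c x
poly-deriv-linearMul n a c x cₙ₊₁≡0 = begin
  poly (suc n) (deriv (linearMul a c)) x
    ≡⟨ poly-cong (suc n) x (deriv-linearMul a c) ⟩
  poly (suc n) (λ t → (shift (deriv c) t + c t) + a * deriv c t) x
    ≡⟨ poly-+ (suc n) (λ t → shift (deriv c) t + c t) (λ t → a * deriv c t) x ⟩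
  poly (suc n) (λ t → shift (deriv c) t + c t) x + poly (suc n) (λ t → a * deriv c t) x
    ≡⟨ cong₂ _+_ (poly-+ (suc n) (shift (deriv c)) c x) (poly-*ˡ (suc n) a (deriv c) x) ⟩
  (poly (suc n) (shift (deriv c)) x + poly (suc n) c x) + a * poly (suc n) (deriv c) x
    ≡⟨ cong₂ (λ p q → (p + poly (suc n) c x) + a * q) (poly-shift n (deriv c) x) (poly-suc-vanishing n (deriv c) x derivₙ≡0) ⟩
  (x * Pd + poly (suc n) c x) + a * Pd
    ≡⟨ solve 4 (λ X A D C → (X :* D :+ C) :+ A :* D := D :* (X :+ A) :+ C) refl x a Pd (poly (suc n) c x) ⟩
  Pd * (x + a) + poly (suc n) c x
    ∎
  where
  Pd : ℤ
  Pd = poly n (deriv c) x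
  derivₙ≡0 : deriv c n ≡ + 0
  derivₙ≡0 = trans (cong (+ suc n *_) cₙ₊₁≡0) (ℤP.*-zeroʳ (+ suc n))

if-*ʳ : ∀ b a y → (if b then a else + 0) * y ≡ (if b then a * y else + 0)
if-*ʳ true  a y = refl
if-*ʳ false a y = ℤP.*-zeroˡ y

poly-* : ∀ n p q (F G : ℕ → ℤ) x → p ℕ.+ q ≤ suc n →
  poly n (λ t → sumℤ p (λ i → sumℤ q (λ j → if i ℕ.+ j ≡ᵇ t then F i * G j else + 0))) x
    ≡ poly p F x * poly q G x
poly-* n p q F G x p+q≤1+n = begin
  sumℤ n (λ t → sumℤ p (λ i → sumℤ q (λ j → if i ℕ.+ j ≡ᵇ t then F i * G j else + 0)) * x ^ t)
    ≡⟨ sumℤ-cong n (λ t _ → trans (sumℤ-*ʳ p _ _) (sumℤ-cong p (λ i _ →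
         trans (sumℤ-*ʳ q _ _) (sumℤ-cong q (λ j _ → if-*ʳ (i ℕ.+ j ≡ᵇ t) _ _))))) ⟩
  sumℤ n (λ t → sumℤ p (λ i → sumℤ q (λ j → if i ℕ.+ j ≡ᵇ t then F i * G j * x ^ t else + 0)))
    ≡⟨ trans (sumℤ-swap n p _) (sumℤ-cong p (λ i _ → sumℤ-swap n q _)) ⟩
  sumℤ p (λ i → sumℤ q (λ j → sumℤ n (λ t → if i ℕ.+ j ≡ᵇ t then F i * G j * x ^ t else + 0)))
    ≡⟨ sumℤ-cong p (λ i i<p → sumℤ-cong q (λ j j<q →
         trans (sumℤ-select n (i ℕ.+ j) _ (i+j<n i<p j<q)) (separate i j))) ⟩
  sumℤ p (λ i → sumℤ q (λ j → (F i * x ^ i) * (G j * x ^ j)))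
    ≡⟨ sumℤ-cong p (λ i _ → sumℤ-*ˡ q (F i * x ^ i) _) ⟨
  sumℤ p (λ i → (F i * x ^ i) * poly q G x)
    ≡⟨ sumℤ-*ʳ p (poly q G x) _ ⟨
  poly p F x * poly q G x
    ∎
  where
  i+j<n : ∀ {i j} → i < p → j < q → i ℕ.+ j < n
  i+j<n {i} {j} i<p j<q =
    ℕP.≤-pred (subst (_≤ suc n) (cong suc (ℕP.+-suc i j)) (ℕP.≤-trans (ℕP.+-mono-≤ i<p j<q) p+q≤1+n))
  separate : ∀ i j → F i * G j * x ^ (i ℕ.+ j) ≡ (F i * x ^ i) * (G j * x ^ j)
  separate i j = begin
    F i * G j * x ^ (i ℕ.+ j)
      ≡⟨ cong (F i * G j *_) (ℤP.^-distribˡ-+-* x i j) ⟩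
    F i * G j * (x ^ i * x ^ j)
      ≡⟨ solve 4 (λ A B P Q → A :* B :* (P :* Q) := (A :* P) :* (B :* Q)) refl (F i) (G j) (x ^ i) (x ^ j) ⟩
    (F i * x ^ i) * (G j * x ^ j)
      ∎

poly-taylor : ∀ d (c : ℕ → ℤ) a b →
  poly d c (a + b) ≡ poly d (λ t → sumℤ (d ∸ t) (λ i → c (t ℕ.+ i) * + ((t ℕ.+ i) C t) * a ^ i)) b
poly-taylor zero    c a b = refl
poly-taylor (suc d) c a b = begin
  poly d c (a + b) + c d * (a + b) ^ d
    ≡⟨ cong₂ _+_ (poly-taylor d c a b) (cong (c d *_) (trans (cong (_^ d) (ℤP.+-comm a b)) (binomial d b a))) ⟩
  poly d (T d) b + c d * sumℤ (suc d) (λ t → + (d C t) * (b ^ t * a ^ (d ∸ t)))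
    ≡⟨ cong₂ _+_ (poly-suc-vanishing d (T d) b T-diagonal) (sym (sumℤ-*ˡ (suc d) (c d) _)) ⟨
  poly (suc d) (T d) b + sumℤ (suc d) (λ t → c d * (+ (d C t) * (b ^ t * a ^ (d ∸ t))))
    ≡⟨ sumℤ-+ (suc d) _ _ ⟨
  sumℤ (suc d) (λ t → T d t * b ^ t + c d * (+ (d C t) * (b ^ t * a ^ (d ∸ t))))
    ≡⟨ sumℤ-cong (suc d) (λ t t<1+d → top-term t (ℕP.≤-pred t<1+d)) ⟩
  poly (suc d) (T (suc d)) b
    ∎
  where
  T : ℕ → ℕ → ℤ
  T e t = sumℤ (e ∸ t) (λ i → c (t ℕ.+ i) * + ((t ℕ.+ i) C t) * a ^ i)
  T-diagonal : T d d ≡ + 0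
  T-diagonal = cong (λ e → sumℤ e (λ i → c (d ℕ.+ i) * + ((d ℕ.+ i) C d) * a ^ i)) (ℕP.n∸n≡0 d)
  top-term : ∀ t → t ≤ d → T d t * b ^ t + c d * (+ (d C t) * (b ^ t * a ^ (d ∸ t))) ≡ T (suc d) t * b ^ t
  top-term t t≤d = begin
    T d t * b ^ t + c d * (+ (d C t) * (b ^ t * a ^ (d ∸ t)))
      ≡⟨ cong (λ e → T d t * b ^ t + c e * (+ (e C t) * (b ^ t * a ^ (d ∸ t)))) (ℕP.m+[n∸m]≡n t≤d) ⟨
    T d t * b ^ t + c (t ℕ.+ (d ∸ t)) * (+ ((t ℕ.+ (d ∸ t)) C t) * (b ^ t * a ^ (d ∸ t)))
      ≡⟨ solve 5 (λ S B K N A → S :* B :+ K :* (N :* (B :* A)) := (S :+ K :* N :* A) :* B) refl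
           (T d t) (b ^ t) (c (t ℕ.+ (d ∸ t))) (+ ((t ℕ.+ (d ∸ t)) C t)) (a ^ (d ∸ t)) ⟩
    (T d t + c (t ℕ.+ (d ∸ t)) * + ((t ℕ.+ (d ∸ t)) C t) * a ^ (d ∸ t)) * b ^ t
      ≡⟨ cong (λ e → sumℤ e (λ i → c (t ℕ.+ i) * + ((t ℕ.+ i) C t) * a ^ i) * b ^ t) (ℕP.+-∸-assoc 1 t≤d) ⟨
    T (suc d) t * b ^ t
      ∎

-- Unsigned Stirling numbers and (x + 1)(x + 2) ⋯ (x + m)

coeff-addP : ∀ p q k → coeff (addP p q) k ≡ coeff p k ℕ.+ coeff q k
coeff-addP []      q       k       = refl
coeff-addP (a ∷ p) []      k       = sym (ℕP.+-identityʳ _)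
coeff-addP (a ∷ p) (b ∷ q) zero    = refl
coeff-addP (a ∷ p) (b ∷ q) (suc k) = coeff-addP p q k

coeff-scaleP : ∀ c p k → coeff (scaleP c p) k ≡ c ℕ.* coeff p k
coeff-scaleP c []      k       = sym (ℕP.*-zeroʳ c)
coeff-scaleP c (a ∷ p) zero    = refl
coeff-scaleP c (a ∷ p) (suc k) = coeff-scaleP c p k

su-suc-zero : ∀ m → su (suc m) 0 ≡ 0
su-suc-zero zero    = refl
su-suc-zero (suc m) = begin
  su (suc (suc m)) 0
    ≡⟨ coeff-addP (0 ∷ rising (suc m)) (scaleP (suc m) (rising (suc m))) 0 ⟩
  coeff (scaleP (suc m) (rising (suc m))) 0
    ≡⟨ coeff-scaleP (suc m) (rising (suc m)) 0 ⟩
  suc m ℕ.* su (suc m) 0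
    ≡⟨ cong (suc m ℕ.*_) (su-suc-zero m) ⟩
  suc m ℕ.* 0
    ≡⟨ ℕP.*-zeroʳ (suc m) ⟩
  0
    ∎

su-suc-suc : ∀ m k → su (suc m) (suc k) ≡ su m k ℕ.+ m ℕ.* su m (suc k)
su-suc-suc m k = trans (coeff-addP (0 ∷ rising m) (scaleP m (rising m)) (suc k))
                       (cong (su m k ℕ.+_) (coeff-scaleP m (rising m) (suc k)))

su-vanishing : ∀ m k → m < k → su m k ≡ 0
su-vanishing zero    (suc k) _         = refl
su-vanishing (suc m) (suc k) (s≤s m<k) = begin
  su (suc m) (suc k)
    ≡⟨ su-suc-suc m k ⟩
  su m k ℕ.+ m ℕ.* su m (suc k)
    ≡⟨ cong₂ (λ a b → a ℕ.+ m ℕ.* b) (su-vanishing m k m<k) (su-vanishing m (suc k) (ℕP.m<n⇒m<1+n m<k)) ⟩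
  m ℕ.* 0
    ≡⟨ ℕP.*-zeroʳ m ⟩
  0
    ∎

-- the coefficients of (x + 1)(x + 2) ⋯ (x + m), i.e. of x(x + 1) ⋯ (x + m) divided by x
risingCoeff : ℕ → ℕ → ℤ
risingCoeff m t = + su (suc m) (suc t)

shift-risingCoeff : ∀ m t → shift (risingCoeff m) t ≡ + su (suc m) t
shift-risingCoeff m zero    = cong +_ (sym (su-suc-zero m))
shift-risingCoeff m (suc t) = refl

risingCoeff-suc : ∀ m t → risingCoeff (suc m) t ≡ linearMul (+ suc m) (risingCoeff m) t
risingCoeff-suc m t = begin
  + su (suc (suc m)) (suc t)                           ≡⟨ cong +_ (su-suc-suc (suc m) t) ⟩
  + (su (suc m) t ℕ.+ suc m ℕ.* su (suc m) (suc t))    ≡⟨ ℤP.pos-+ (su (suc m) t) _ ⟩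
  + su (suc m) t + + (suc m ℕ.* su (suc m) (suc t))    ≡⟨ cong₂ _+_ (shift-risingCoeff m t) (sym (ℤP.pos-* (suc m) _)) ⟨
  shift (risingCoeff m) t + + suc m * risingCoeff m t  ∎

risingCoeff-vanishing : ∀ m → risingCoeff m (suc m) ≡ + 0
risingCoeff-vanishing m = cong +_ (su-vanishing (suc m) (suc (suc m)) (ℕP.n<1+n (suc m)))
poly-risingCoeff-suc : ∀ m x →
  poly (suc (suc m)) (risingCoeff (suc m)) x ≡ poly (suc m) (risingCoeff m) x * (x + + suc m)
poly-risingCoeff-suc m x = begin
  poly (suc (suc m)) (risingCoeff (suc m)) x
    ≡⟨ poly-cong (suc (suc m)) x (risingCoeff-suc m) ⟩
  poly (suc (suc m)) (linearMul (+ suc m) (risingCoeff m)) x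
    ≡⟨ poly-linearMul (suc m) (+ suc m) (risingCoeff m) x (risingCoeff-vanishing m) ⟩
  poly (suc m) (risingCoeff m) x * (x + + suc m)
    ∎

poly-deriv-risingCoeff-suc : ∀ m x →
  poly (suc m) (deriv (risingCoeff (suc m))) x
    ≡ poly m (deriv (risingCoeff m)) x * (x + + suc m) + poly (suc m) (risingCoeff m) x
poly-deriv-risingCoeff-suc m x = begin
  poly (suc m) (deriv (risingCoeff (suc m))) x
    ≡⟨ poly-cong (suc m) x (λ t → cong (+ suc t *_) (risingCoeff-suc m (suc t))) ⟩
  poly (suc m) (deriv (linearMul (+ suc m) (risingCoeff m))) x
    ≡⟨ poly-deriv-linearMul m (+ suc m) (risingCoeff m) x (risingCoeff-vanishing m) ⟩
  poly m (deriv (risingCoeff m)) x * (x + + suc m) + poly (suc m) (risingCoeff m) x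
    ∎

poly-risingCoeff-*-factorial : ∀ m ℓ → poly (suc m) (risingCoeff m) (+ ℓ) * + (ℓ !) ≡ + ((ℓ ℕ.+ m) !)
poly-risingCoeff-*-factorial zero    ℓ = trans (ℤP.*-identityˡ (+ (ℓ !))) (cong (λ k → + (k !)) (sym (ℕP.+-identityʳ ℓ)))
poly-risingCoeff-*-factorial (suc m) ℓ = begin
  poly (suc (suc m)) (risingCoeff (suc m)) (+ ℓ) * + (ℓ !)
    ≡⟨ cong (_* + (ℓ !)) (poly-risingCoeff-suc m (+ ℓ)) ⟩
  poly (suc m) (risingCoeff m) (+ ℓ) * (+ ℓ + + suc m) * + (ℓ !)
    ≡⟨ solve 3 (λ P L F → P :* L :* F := P :* F :* L) refl (poly (suc m) (risingCoeff m) (+ ℓ)) (+ ℓ + + suc m) (+ (ℓ !)) ⟩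
  poly (suc m) (risingCoeff m) (+ ℓ) * + (ℓ !) * + (ℓ ℕ.+ suc m)
    ≡⟨ cong (_* + (ℓ ℕ.+ suc m)) (poly-risingCoeff-*-factorial m ℓ) ⟩
  + ((ℓ ℕ.+ m) !) * + (ℓ ℕ.+ suc m)
    ≡⟨ ℤP.pos-* ((ℓ ℕ.+ m) !) (ℓ ℕ.+ suc m) ⟨
  + ((ℓ ℕ.+ m) ! ℕ.* (ℓ ℕ.+ suc m))
    ≡⟨ cong +_ (trans (ℕP.*-comm ((ℓ ℕ.+ m) !) _) (cong (λ k → k ℕ.* (ℓ ℕ.+ m) !) (ℕP.+-suc ℓ m))) ⟩
  + (suc (ℓ ℕ.+ m) !)
    ≡⟨ cong (λ k → + (k !)) (ℕP.+-suc ℓ m) ⟨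
  + ((ℓ ℕ.+ suc m) !)
    ∎

nCk*[k!*[n∸k]!]≡n! : ∀ {n k} → k ≤ n → (n C k) ℕ.* (k ! ℕ.* (n ∸ k) !) ≡ n !
nCk*[k!*[n∸k]!]≡n! {n} {k} k≤n = trans (cong (ℕ._* (k ! ℕ.* (n ∸ k) !)) (nCk≡n!/k![n-k]! k≤n))
  (m/n*n≡m {{ℕP._!*_!≢0 k (n ∸ k)}} (k![n∸k]!∣n! k≤n))

poly-risingCoeff-nat : ∀ m ℓ → poly (suc m) (risingCoeff m) (+ ℓ) ≡ + (((ℓ ℕ.+ m) C m) ℕ.* m !)
poly-risingCoeff-nat m ℓ = ℤP.*-cancelʳ-≡ _ _ (+ (ℓ !)) {{ℕP._!≢0 ℓ}} (begin
  poly (suc m) (risingCoeff m) (+ ℓ) * + (ℓ !)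
    ≡⟨ poly-risingCoeff-*-factorial m ℓ ⟩
  + ((ℓ ℕ.+ m) !)
    ≡⟨ cong +_ (nCk*[k!*[n∸k]!]≡n! (ℕP.m≤n+m m ℓ)) ⟨
  + (((ℓ ℕ.+ m) C m) ℕ.* (m ! ℕ.* (ℓ ℕ.+ m ∸ m) !))
    ≡⟨ cong (λ k → + (((ℓ ℕ.+ m) C m) ℕ.* (m ! ℕ.* k !))) (ℕP.m+n∸n≡m ℓ m) ⟩
  + (((ℓ ℕ.+ m) C m) ℕ.* (m ! ℕ.* ℓ !))
    ≡⟨ cong +_ (ℕP.*-assoc ((ℓ ℕ.+ m) C m) (m !) (ℓ !)) ⟨
  + (((ℓ ℕ.+ m) C m) ℕ.* m ! ℕ.* ℓ !)
    ≡⟨ ℤP.pos-* (((ℓ ℕ.+ m) C m) ℕ.* m !) (ℓ !) ⟩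
  + (((ℓ ℕ.+ m) C m) ℕ.* m !) * + (ℓ !)
    ∎)

poly-risingCoeff-*-nat : ∀ m k ℓ ℓ′ →
  poly (suc m) (risingCoeff m) (+ ℓ) * poly (suc k) (risingCoeff k) (+ ℓ′)
    ≡ + (((ℓ ℕ.+ m) C m) ℕ.* ((ℓ′ ℕ.+ k) C k) ℕ.* (m ! ℕ.* k !))
poly-risingCoeff-*-nat m k ℓ ℓ′ = begin
  poly (suc m) (risingCoeff m) (+ ℓ) * poly (suc k) (risingCoeff k) (+ ℓ′)
    ≡⟨ cong₂ _*_ (poly-risingCoeff-nat m ℓ) (poly-risingCoeff-nat k ℓ′) ⟩
  + (((ℓ ℕ.+ m) C m) ℕ.* m !) * + (((ℓ′ ℕ.+ k) C k) ℕ.* k !)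
    ≡⟨ ℤP.pos-* (((ℓ ℕ.+ m) C m) ℕ.* m !) _ ⟨
  + (((ℓ ℕ.+ m) C m) ℕ.* m ! ℕ.* (((ℓ′ ℕ.+ k) C k) ℕ.* k !))
    ≡⟨ cong +_ (ℕP.[m*n]*[o*p]≡[m*o]*[n*p] ((ℓ ℕ.+ m) C m) (m !) ((ℓ′ ℕ.+ k) C k) (k !)) ⟩
  + (((ℓ ℕ.+ m) C m) ℕ.* ((ℓ′ ℕ.+ k) C k) ℕ.* (m ! ℕ.* k !))
    ∎

poly-innerSum : ∀ k n ℓ → ℓ ≤ n →
  poly (suc k) (innerSum (suc k) n) (+ ℓ) ≡ poly (suc k) (risingCoeff k) (+ (n ∸ ℓ))
poly-innerSum k n ℓ ℓ≤n = begin
  sumℤ (suc k) (λ t → innerSum (suc k) n t * (+ ℓ) ^ t)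
    ≡⟨ sumℤ-cong (suc k) (λ t _ → term t) ⟩
  poly (suc k) T (- + ℓ)
    ≡⟨ poly-taylor (suc k) (risingCoeff k) (+ n) (- + ℓ) ⟨
  poly (suc k) (risingCoeff k) (+ n + - + ℓ)
    ≡⟨ cong (poly (suc k) (risingCoeff k)) (trans (ℤP.m-n≡m⊖n n ℓ) (ℤP.⊖-≥ ℓ≤n)) ⟩
  poly (suc k) (risingCoeff k) (+ (n ∸ ℓ))
    ∎
  where
  T : ℕ → ℤ
  T t = sumℤ (suc k ∸ t) (λ i → risingCoeff k (t ℕ.+ i) * + ((t ℕ.+ i) C t) * (+ n) ^ i)
  summand : ∀ t i → + (su (suc k) (t ℕ.+ i ℕ.+ 1) ℕ.* ((t ℕ.+ i) C t) ℕ.* (n ℕ.^ i))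
                  ≡ risingCoeff k (t ℕ.+ i) * + ((t ℕ.+ i) C t) * (+ n) ^ i
  summand t i = begin
    + (su (suc k) (t ℕ.+ i ℕ.+ 1) ℕ.* ((t ℕ.+ i) C t) ℕ.* (n ℕ.^ i))
      ≡⟨ cong (λ j → + (su (suc k) j ℕ.* ((t ℕ.+ i) C t) ℕ.* (n ℕ.^ i))) (ℕP.+-comm (t ℕ.+ i) 1) ⟩
    + (su (suc k) (suc (t ℕ.+ i)) ℕ.* ((t ℕ.+ i) C t) ℕ.* (n ℕ.^ i))
      ≡⟨ ℤP.pos-* (su (suc k) (suc (t ℕ.+ i)) ℕ.* ((t ℕ.+ i) C t)) (n ℕ.^ i) ⟩
    + (su (suc k) (suc (t ℕ.+ i)) ℕ.* ((t ℕ.+ i) C t)) * + (n ℕ.^ i)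
      ≡⟨ cong₂ _*_ (ℤP.pos-* (su (suc k) (suc (t ℕ.+ i))) ((t ℕ.+ i) C t)) (pos-^ n i) ⟩
    risingCoeff k (t ℕ.+ i) * + ((t ℕ.+ i) C t) * (+ n) ^ i
      ∎
  term : ∀ t → innerSum (suc k) n t * (+ ℓ) ^ t ≡ T t * (- + ℓ) ^ t
  term t = begin
    innerSum (suc k) n t * (+ ℓ) ^ t
      ≡⟨ cong (_* (+ ℓ) ^ t) (trans (sumℤ-cong (suc k ∸ t) (λ i _ → cong (_* ℤ.-1ℤ ^ t) (summand t i)))
                                  (sym (sumℤ-*ʳ (suc k ∸ t) (ℤ.-1ℤ ^ t) _))) ⟩
    T t * ℤ.-1ℤ ^ t * (+ ℓ) ^ t
      ≡⟨ ℤP.*-assoc (T t) (ℤ.-1ℤ ^ t) ((+ ℓ) ^ t) ⟩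
    T t * (ℤ.-1ℤ ^ t * (+ ℓ) ^ t)
      ≡⟨ cong (T t *_) (trans (sym (^-distribʳ-* ℤ.-1ℤ (+ ℓ) t)) (cong (_^ t) (ℤP.-1*i≡-i (+ ℓ)))) ⟩
    T t * (- + ℓ) ^ t
      ∎

-- The numerator of a2, written exactly as in its definition so that a2 unfolds to it.
a2-numerator : ℕ → ℕ → ℕ → ℕ → ℤ
a2-numerator r s n t =
  sumℤ (r ∸ 1) (λ t1 → sumℤ s (λ t2 →
     if (t1 ℕ.+ t2) ≡ᵇ t
       then ℤ.+ (su r (t1 ℕ.+ 2) ℕ.* (t1 ℕ.+ 1)) ℤ.* innerSum s n t2
       else + 0))

poly-a2-numerator : ∀ m k n ℓ → ℓ ≤ n →
  poly (m ℕ.+ k) (a2-numerator (suc m) (suc k) n) (+ ℓ)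
    ≡ poly m (deriv (risingCoeff m)) (+ ℓ) * poly (suc k) (risingCoeff k) (+ (n ∸ ℓ))
poly-a2-numerator m k n ℓ ℓ≤n = begin
  poly (m ℕ.+ k) (a2-numerator (suc m) (suc k) n) (+ ℓ)
    ≡⟨ poly-* (m ℕ.+ k) m (suc k) F (innerSum (suc k) n) (+ ℓ) (ℕP.≤-reflexive (ℕP.+-suc m k)) ⟩
  poly m F (+ ℓ) * poly (suc k) (innerSum (suc k) n) (+ ℓ)
    ≡⟨ cong₂ _*_ (poly-cong m (+ ℓ) F≡deriv) (poly-innerSum k n ℓ ℓ≤n) ⟩
  poly m (deriv (risingCoeff m)) (+ ℓ) * poly (suc k) (risingCoeff k) (+ (n ∸ ℓ))
    ∎
  where
  F : ℕ → ℤ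
  F t = + (su (suc m) (t ℕ.+ 2) ℕ.* (t ℕ.+ 1))
  F≡deriv : ∀ t → F t ≡ deriv (risingCoeff m) t
  F≡deriv t = begin
    + (su (suc m) (t ℕ.+ 2) ℕ.* (t ℕ.+ 1))
      ≡⟨ cong₂ (λ i j → + (su (suc m) i ℕ.* j)) (ℕP.+-comm t 2) (ℕP.+-comm t 1) ⟩
    + (su (suc m) (suc (suc t)) ℕ.* suc t)
      ≡⟨ cong +_ (ℕP.*-comm (su (suc m) (suc (suc t))) (suc t)) ⟩
    + (suc t ℕ.* su (suc m) (suc (suc t)))
      ≡⟨ ℤP.pos-* (suc t) _ ⟩
    deriv (risingCoeff m) t
      ∎

-- Passing to ℚ

toℚ : ℤ → ℚ
toℚ z = z / 1

toℚ≡fromℤ : ∀ z → toℚ z ≡ fromℤ z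
toℚ≡fromℤ (+ n)      = ℚP.normalize-coprime (coprime-sym (1-coprimeTo n))
toℚ≡fromℤ ℤ.-[1+ n ] = cong ℚ.-_ (ℚP.normalize-coprime (coprime-sym (1-coprimeTo (suc n))))

toℚ-+ : ∀ a b → toℚ (a + b) ≡ toℚ a ℚ.+ toℚ b
toℚ-+ a b = begin
  toℚ (a + b)             ≡⟨ ℚP./-cong (sym (cong₂ _+_ (ℤP.*-identityʳ a) (ℤP.*-identityʳ b))) refl ⟩
  fromℤ a ℚ.+ fromℤ b     ≡⟨ cong₂ ℚ._+_ (toℚ≡fromℤ a) (toℚ≡fromℤ b) ⟨
  toℚ a ℚ.+ toℚ b         ∎

toℚ-* : ∀ a b → toℚ (a * b) ≡ toℚ a ℚ.* toℚ b
toℚ-* a b = sym (cong₂ ℚ._*_ (toℚ≡fromℤ a) (toℚ≡fromℤ b))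

toℚ-sumℤ : ∀ m (f : ℕ → ℤ) → toℚ (sumℤ m f) ≡ sumℚ m (λ i → toℚ (f i))
toℚ-sumℤ zero    f = refl
toℚ-sumℤ (suc m) f = trans (toℚ-+ (sumℤ m f) (f m)) (cong (ℚ._+ toℚ (f m)) (toℚ-sumℤ m f))

toℚ-^ : ∀ x t → toℚ (x ^ t) ≡ powℚ (toℚ x) t
toℚ-^ x zero    = refl
toℚ-^ x (suc t) = begin
  toℚ (x * x ^ t)              ≡⟨ toℚ-* x (x ^ t) ⟩
  toℚ x ℚ.* toℚ (x ^ t)        ≡⟨ ℚP.*-comm (toℚ x) (toℚ (x ^ t)) ⟩
  toℚ (x ^ t) ℚ.* toℚ x        ≡⟨ cong (ℚ._* toℚ x) (toℚ-^ x t) ⟩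
  powℚ (toℚ x) t ℚ.* toℚ x     ∎

1/n*toℚn≡1 : ∀ n .{{_ : ℕ.NonZero n}} → (+ 1 / n) ℚ.* toℚ (+ n) ≡ 1ℚ
1/n*toℚn≡1 (suc n) = begin
  (+ 1 / suc n) ℚ.* toℚ (+ suc n)
    ≡⟨ cong₂ ℚ._*_ (ℚP.normalize-coprime (1-coprimeTo (suc n))) (toℚ≡fromℤ (+ suc n)) ⟩
  ℚ.1/ (fromℤ (+ suc n)) ℚ.* fromℤ (+ suc n)
    ≡⟨ ℚP.*-inverseˡ (fromℤ (+ suc n)) ⟩
  1ℚ
    ∎

1/n*toℚ[m*n]≡toℚm : ∀ m n .{{_ : ℕ.NonZero n}} → (+ 1 / n) ℚ.* toℚ (+ (m ℕ.* n)) ≡ toℚ (+ m)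
1/n*toℚ[m*n]≡toℚm m n = begin
  (+ 1 / n) ℚ.* toℚ (+ (m ℕ.* n))             ≡⟨ cong (λ z → (+ 1 / n) ℚ.* toℚ z) (ℤP.pos-* m n) ⟩
  (+ 1 / n) ℚ.* toℚ (+ m * + n)               ≡⟨ cong ((+ 1 / n) ℚ.*_) (toℚ-* (+ m) (+ n)) ⟩
  (+ 1 / n) ℚ.* (toℚ (+ m) ℚ.* toℚ (+ n))     ≡⟨ cong ((+ 1 / n) ℚ.*_) (ℚP.*-comm (toℚ (+ m)) (toℚ (+ n))) ⟩
  (+ 1 / n) ℚ.* (toℚ (+ n) ℚ.* toℚ (+ m))     ≡⟨ ℚP.*-assoc (+ 1 / n) (toℚ (+ n)) (toℚ (+ m)) ⟨
  (+ 1 / n) ℚ.* toℚ (+ n) ℚ.* toℚ (+ m)       ≡⟨ cong (ℚ._* toℚ (+ m)) (1/n*toℚn≡1 n) ⟩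
  1ℚ ℚ.* toℚ (+ m)                            ≡⟨ ℚP.*-identityˡ (toℚ (+ m)) ⟩
  toℚ (+ m)                                   ∎

sumℚ-cong : ∀ m {f g : ℕ → ℚ} → (∀ i → f i ≡ g i) → sumℚ m f ≡ sumℚ m g
sumℚ-cong zero    f≡g = refl
sumℚ-cong (suc m) f≡g = cong₂ ℚ._+_ (sumℚ-cong m f≡g) (f≡g m)

sumℚ-*ˡ : ∀ m c (f : ℕ → ℚ) → c ℚ.* sumℚ m f ≡ sumℚ m (λ i → c ℚ.* f i)
sumℚ-*ˡ zero    c f = ℚP.*-zeroʳ c
sumℚ-*ˡ (suc m) c f = trans (ℚP.*-distribˡ-+ c (sumℚ m f) (f m)) (cong (ℚ._+ c ℚ.* f m) (sumℚ-*ˡ m c f))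

toℚ-poly-deriv-risingCoeff : ∀ m ℓ →
  toℚ (poly m (deriv (risingCoeff m)) (+ ℓ))
    ≡ toℚ (poly (suc m) (risingCoeff m) (+ ℓ)) ℚ.* sumℚ m (λ i → + 1 / suc (ℓ ℕ.+ i))
toℚ-poly-deriv-risingCoeff zero    ℓ = sym (ℚP.*-zeroʳ (toℚ (poly 1 (risingCoeff 0) (+ ℓ))))
toℚ-poly-deriv-risingCoeff (suc m) ℓ = begin
  toℚ (poly (suc m) (deriv (risingCoeff (suc m))) x)  ≡⟨ cong toℚ (poly-deriv-risingCoeff-suc m x) ⟩
  toℚ (D * y + V)                                     ≡⟨ trans (toℚ-+ (D * y) V) (cong (ℚ._+ toℚ V) (toℚ-* D y)) ⟩
  toℚ D ℚ.* toℚ y ℚ.+ toℚ V                           ≡⟨ cong₂ (λ d u → d ℚ.* toℚ y ℚ.+ u)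
                                                           (toℚ-poly-deriv-risingCoeff m ℓ) (sym (ℚP.*-identityʳ (toℚ V))) ⟩
  toℚ V ℚ.* H ℚ.* toℚ y ℚ.+ toℚ V ℚ.* 1ℚ              ≡⟨ cong (λ u → toℚ V ℚ.* H ℚ.* toℚ y ℚ.+ toℚ V ℚ.* u) R*y≡1 ⟨
  toℚ V ℚ.* H ℚ.* toℚ y ℚ.+ toℚ V ℚ.* (R ℚ.* toℚ y)   ≡⟨ QS.solve 4 (λ V H Y R → V QS.:* H QS.:* Y QS.:+ V QS.:* (R QS.:* Y)
                                                                          QS.:= (V QS.:* Y) QS.:* (H QS.:+ R))
                                                           refl (toℚ V) H (toℚ y) R ⟩
  (toℚ V ℚ.* toℚ y) ℚ.* (H ℚ.+ R)                     ≡⟨ cong (ℚ._* (H ℚ.+ R)) (toℚ-* V y) ⟨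
  toℚ (V * y) ℚ.* (H ℚ.+ R)                           ≡⟨ cong (λ z → toℚ z ℚ.* (H ℚ.+ R)) (poly-risingCoeff-suc m x) ⟨
  toℚ (poly (suc (suc m)) (risingCoeff (suc m)) x) ℚ.* (H ℚ.+ R) ∎
  where
  x y D V : ℤ
  x = + ℓ
  y = x + + suc m
  D = poly m (deriv (risingCoeff m)) x
  V = poly (suc m) (risingCoeff m) x
  H R : ℚ
  H = sumℚ m (λ i → + 1 / suc (ℓ ℕ.+ i))
  R = + 1 / suc (ℓ ℕ.+ m)
  R*y≡1 : R ℚ.* toℚ y ≡ 1ℚ
  R*y≡1 = trans (cong (λ k → R ℚ.* toℚ (+ k)) (ℕP.+-suc ℓ m)) (1/n*toℚn≡1 (suc (ℓ ℕ.+ m)))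

sumℚ-*toℚ-poly : ∀ n c (d : ℕ → ℤ) x →
  sumℚ n (λ t → (c ℚ.* toℚ (d t)) ℚ.* powℚ (toℚ x) t) ≡ c ℚ.* toℚ (poly n d x)
sumℚ-*toℚ-poly n c d x = begin
  sumℚ n (λ t → (c ℚ.* toℚ (d t)) ℚ.* powℚ (toℚ x) t)
    ≡⟨ sumℚ-cong n (λ t → ℚP.*-assoc c (toℚ (d t)) _) ⟩
  sumℚ n (λ t → c ℚ.* (toℚ (d t) ℚ.* powℚ (toℚ x) t))
    ≡⟨ sumℚ-*ˡ n c _ ⟨
  c ℚ.* sumℚ n (λ t → toℚ (d t) ℚ.* powℚ (toℚ x) t)
    ≡⟨ cong (c ℚ.*_) (sumℚ-cong n (λ t → cong (toℚ (d t) ℚ.*_) (toℚ-^ x t))) ⟨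
  c ℚ.* sumℚ n (λ t → toℚ (d t) ℚ.* toℚ (x ^ t))
    ≡⟨ cong (c ℚ.*_) (sumℚ-cong n (λ t → toℚ-* (d t) (x ^ t))) ⟨
  c ℚ.* sumℚ n (λ t → toℚ (d t * x ^ t))
    ≡⟨ cong (c ℚ.*_) (toℚ-sumℤ n _) ⟨
  c ℚ.* toℚ (poly n d x)
    ∎

lemma5 : (r s n ℓ : ℕ) → 1 ≤ r → 1 ≤ s → 1 ≤ n → ℓ ≤ n →
    (+ (((ℓ ℕ.+ r ∸ 1) C (r ∸ 1)) ℕ.* ((n ∸ ℓ ℕ.+ s ∸ 1) C (s ∸ 1))) / 1)
      ℚ.* sumℚ (r ∸ 1) (λ i → + 1 / suc (ℓ ℕ.+ i))
    ≡ sumℚ (r ℕ.+ s ∸ 2) (λ t → a2 r s n t ℚ.* powℚ (+ ℓ / 1) t)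
lemma5 (suc m) (suc k) n ℓ _ _ _ ℓ≤n = sym (begin
  sumℚ (suc m ℕ.+ suc k ∸ 2) (λ t → (c ℚ.* toℚ (A t)) ℚ.* powℚ (toℚ x) t)
    ≡⟨ cong (λ N → sumℚ N (λ t → (c ℚ.* toℚ (A t)) ℚ.* powℚ (toℚ x) t)) (cong (_∸ 1) (ℕP.+-suc m k)) ⟩
  sumℚ (m ℕ.+ k) (λ t → (c ℚ.* toℚ (A t)) ℚ.* powℚ (toℚ x) t)
    ≡⟨ sumℚ-*toℚ-poly (m ℕ.+ k) c A x ⟩
  c ℚ.* toℚ (poly (m ℕ.+ k) A x)
    ≡⟨ cong (λ z → c ℚ.* toℚ z) (poly-a2-numerator m k n ℓ ℓ≤n) ⟩
  c ℚ.* toℚ (D * W)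
    ≡⟨ cong (c ℚ.*_) (trans (toℚ-* D W) (cong (ℚ._* toℚ W) (toℚ-poly-deriv-risingCoeff m ℓ))) ⟩
  c ℚ.* (toℚ V ℚ.* H ℚ.* toℚ W)
    ≡⟨ QS.solve 4 (λ C v H w → C QS.:* (v QS.:* H QS.:* w) QS.:= C QS.:* (v QS.:* w) QS.:* H) refl c (toℚ V) H (toℚ W) ⟩
  c ℚ.* (toℚ V ℚ.* toℚ W) ℚ.* H
    ≡⟨ cong (λ z → c ℚ.* z ℚ.* H) (trans (sym (toℚ-* V W)) (cong toℚ (poly-risingCoeff-*-nat m k ℓ (n ∸ ℓ)))) ⟩
  c ℚ.* toℚ (+ (C₁ ℕ.* C₂ ℕ.* (m ! ℕ.* k !))) ℚ.* H
    ≡⟨ cong (ℚ._* H) (1/n*toℚ[m*n]≡toℚm (C₁ ℕ.* C₂) (m ! ℕ.* k !) {{ℕP._!*_!≢0 m k}}) ⟩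
  toℚ (+ (C₁ ℕ.* C₂)) ℚ.* H
    ≡⟨ cong₂ (λ a b → toℚ (+ ((a C m) ℕ.* (b C k))) ℚ.* H) (cong (_∸ 1) (ℕP.+-suc ℓ m)) (cong (_∸ 1) (ℕP.+-suc (n ∸ ℓ) k)) ⟨
  toℚ (+ (((ℓ ℕ.+ suc m ∸ 1) C m) ℕ.* ((n ∸ ℓ ℕ.+ suc k ∸ 1) C k))) ℚ.* H
    ∎)
  where
  x D V W : ℤ
  x = + ℓ
  D = poly m (deriv (risingCoeff m)) x
  V = poly (suc m) (risingCoeff m) x
  W = poly (suc k) (risingCoeff k) (+ (n ∸ ℓ))
  A : ℕ → ℤ
  A = a2-numerator (suc m) (suc k) n
  c H : ℚ
  c = (+ 1 / (m ! ℕ.* k !)) {{ℕP._!*_!≢0 m k}}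
  H = sumℚ m (λ i → + 1 / suc (ℓ ℕ.+ i))
  C₁ C₂ : ℕ
  C₁ = (ℓ ℕ.+ m) C m
  C₂ = (n ∸ ℓ ℕ.+ k) C k
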